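{- For every context $\Gamma$ and terms $M, A$: if $\Gamma\vdash M:A$, then there exists $s\in\mathcal{C}$ such that either $A=\mathsf{c}\,s$ or $\Gamma\vdash A:\mathsf{c}\,s$.
   Context: Variables $\mathcal{V}$: a type with decidable equality and maps $\mathrm{encode}:\mathcal{V}\to\mathbb{N}$, $\mathrm{decode}:\mathbb{N}\to\mathcal{V}$ with $\mathrm{encode}(\mathrm{decode}\,n)=n$. Constants $\mathcal{C}$: any type. Terms: $\mathsf{c}\,k$, $\mathsf{v}\,x$, $\lambda[x:A]M$, $\Pi[x:A]B$, $M\cdot N$. Free-variable list: $\mathrm{fv}(\mathsf{c}\,k)=[\,]$, $\mathrm{fv}(\mathsf{v}\,x)=[x]$, $\mathrm{fv}(\lambda[x:A]M)=\mathrm{fv}\,A\mathbin{++}(\mathrm{fv}\,M-x)$, likewise $\Pi$, $\mathrm{fv}(M\cdot N)=\mathrm{fv}\,M\mathbin{++}\mathrm{fv}\,N$ ($xs-x$ removes all occurrences of $x$). Substitutions $\sigma:\mathcal{V}\to\Lambda$; $\iota\,x=\mathsf{v}\,x$; $(\sigma,x:=N)$ sends $x$ to $N$, $y\neq x$ to $\sigma\,y$. Fix $\chi':\mathrm{List}\,\mathbb{N}\to\mathbb{N}$ with $\chi'(ns)\notin ns$; $X'(xs)=\mathrm{decode}(\chi'(\mathrm{map\ encode}\ xs))$; $X(\sigma,xs)=X'$(concatenation of $\mathrm{fv}(\sigma\,y)$ for $y$ in $xs$). Substitution: $\mathsf{c}\,k\bullet\sigma=\mathsf{c}\,k$, $\mathsf{v}\,x\bullet\sigma=\sigma\,x$,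 $(M\cdot N)\bullet\sigma=(M\bullet\sigma)\cdot(N\bullet\sigma)$, $(\lambda[x:A]M)\bullet\sigma=\lambda[y:A\bullet\sigma](M\bullet(\sigma,x:=\mathsf{v}\,y))$ with $y=X(\sigma,\mathrm{fv}\,M-x)$, analogously for $\Pi$ (with $y=X(\sigma,\mathrm{fv}\,B-x)$). $M[x:=N]=M\bullet(\iota,x:=N)$. Alpha-conversion $\sim_\alpha$: inductive, $\mathsf{c}\,k\sim_\alpha\mathsf{c}\,k$, $\mathsf{v}\,x\sim_\alpha\mathsf{v}\,x$, congruence for application, and $\lambda[x:A]M\sim_\alpha\lambda[x':A']M'$ whenever $A\sim_\alpha A'$, $y\notin\mathrm{fv}\,M-x$, $y\notin\mathrm{fv}\,M'-x'$ and $M[x:=\mathsf{v}\,y]=M'[x':=\mathsf{v}\,y]$ syntactically, for some $y$ (same for $\Pi$). Beta: the contextual closure of a relation $S$ is the least relation containing $S$ and closed under rewriting in the body or annotation of $\lambda$, in the codomain or domain of $\Pi$, and in either side of an application; $\to_\beta$ is the contextual closure of $(\lambda[x:A]M)\cdot N\ \triangleright\ M[x:=N]$; $\simeq_\beta$ is the reflexive–symmetric–transitive closure of $\sim_\alpha\cup\to_\beta$. PTS: fix $\mathcal{A}\subseteq\mathcal{C}^2$ (axioms) and $\mathcal{R}\subseteq\mathcal{C}^3$ (rules). A context is a list of pairs $(x,A)$; $\Gamma,x:A$ denotes $(x,A)::\Gamma$; $\mathrm{dom}\,\Gamma$ is the list of first components. The judgments $\Gamma\ \mathrm{ok}$ and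 $\Gamma\vdash M:A$ are mutually inductively defined by: (nil) $[\,]\ \mathrm{ok}$; (cons) if $\Gamma\ \mathrm{ok}$, $\Gamma\vdash A:\mathsf{c}\,s$ and $x\notin\mathrm{dom}\,\Gamma$ then $(\Gamma,x:A)\ \mathrm{ok}$; (sort) if $\Gamma\ \mathrm{ok}$ and $\mathcal{A}\,s_1\,s_2$ then $\Gamma\vdash\mathsf{c}\,s_1:\mathsf{c}\,s_2$; (prod) if $\Gamma\vdash A:\mathsf{c}\,s_1$, for every $y\notin\mathrm{dom}\,\Gamma$ we have $\Gamma,y:A\vdash B[x:=\mathsf{v}\,y]:\mathsf{c}\,s_2$, and $\mathcal{R}\,s_1\,s_2\,s_3$, then $\Gamma\vdash\Pi[x:A]B:\mathsf{c}\,s_3$; (var) if $\Gamma\ \mathrm{ok}$ and $(x,A)\in\Gamma$ then $\Gamma\vdash\mathsf{v}\,x:A$; (abs) if $\Gamma\vdash A:\mathsf{c}\,s_1$, for every $z\notin\mathrm{dom}\,\Gamma$ both $\Gamma,z:A\vdash B[y:=\mathsf{v}\,z]:\mathsf{c}\,s_2$ and $\Gamma,z:A\vdash M[x:=\mathsf{v}\,z]:B[y:=\mathsf{v}\,z]$, and $\mathcal{R}\,s_1\,s_2\,s_3$, then $\Gamma\vdash\lambda[x:A]M:\Pi[y:A]B$; (app) if $\Gamma\vdash M:\Pi[x:A]B$, $\Gamma\vdash N:A$ and $\Gamma\vdash B[x:=N]:\mathsf{c}\,s$, then $\Gamma\vdash M\cdot N:B[x:=N]$; (conv) if $\Gamma\vdash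 M:A$, $A\simeq_\beta B$ and $\Gamma\vdash B:\mathsf{c}\,s$ then $\Gamma\vdash M:B$. -}

module Defs where

open import Level using (Level; _⊔_) renaming (suc to lsuc)
open import Data.Nat using (ℕ)
open import Data.List using (List; []; _∷_; _++_; map; concatMap; filterᵇ)
open import Data.List.Membership.Propositional using (_∈_)
open import Data.Product using (_×_; _,_; Σ; ∃)
open import Data.Sum using (_⊎_)
open import Data.Bool using (Bool; true; false; not)
open import Relation.Nullary using (¬_; Dec; yes; no; does)
open import Relation.Binary.PropositionalEquality using (_≡_)
open import Relation.Binary using (DecidableEquality)

module PTS
  {ℓv ℓc ℓa ℓr : Level}
  (𝒱 : Set ℓv) (_≟_ : DecidableEquality 𝒱)
  (encode : 𝒱 → ℕ) (decode : ℕ → 𝒱)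
  (encode-decode : ∀ n → encode (decode n) ≡ n)
  (𝒞 : Set ℓc)
  (χ′ : List ℕ → ℕ) (χ′-fresh : ∀ ns → ¬ (χ′ ns ∈ ns))
  (𝒜 : 𝒞 → 𝒞 → Set ℓa)
  (ℛ : 𝒞 → 𝒞 → 𝒞 → Set ℓr)
  where

  infixl 30 _·_
  infix 25 _[_≔_]
  infix 25 _●_
  infix 10 _⊢_∶_
  infix 10 _∼α_ _≃β_ _→β_
  infixl 15 _,,_∶_
  infix 10 _ok

  data Λ : Set (ℓv ⊔ ℓc) where
    c   : 𝒞 → Λ
    v   : 𝒱 → Λ
    lam : 𝒱 → Λ → Λ → Λ      -- λ[x:A]M  =  lam x A M
    pi  : 𝒱 → Λ → Λ → Λ      -- Π[x:A]B  =  pi x A B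
    _·_ : Λ → Λ → Λ

  _-_ : List 𝒱 → 𝒱 → List 𝒱
  xs - x = filterᵇ (λ y → not (does (y ≟ x))) xs

  fv : Λ → List 𝒱
  fv (c k) = []
  fv (v x) = x ∷ []
  fv (lam x A M) = fv A ++ (fv M - x)
  fv (pi x A B) = fv A ++ (fv B - x)
  fv (M · N) = fv M ++ fv N

  Subst : Set (ℓv ⊔ ℓc)
  Subst = 𝒱 → Λ

  ι : Subst
  ι x = v x

  _,_≔_ : Subst → 𝒱 → Λ → Subst
  (σ , x ≔ N) y with y ≟ x
  ... | yes _ = N
  ... | no  _ = σ y

  X′ : List 𝒱 → 𝒱
  X′ xs = decode (χ′ (map encode xs))

  X : Subst → List 𝒱 → 𝒱
  X σ xs = X′ (concatMap (λ y → fv (σ y)) xs)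

  _●_ : Λ → Subst → Λ
  c k ● σ = c k
  v x ● σ = σ x
  (M · N) ● σ = (M ● σ) · (N ● σ)
  lam x A M ● σ = let y = X σ (fv M - x) in lam y (A ● σ) (M ● (σ , x ≔ v y))
  pi x A B ● σ = let y = X σ (fv B - x) in pi y (A ● σ) (B ● (σ , x ≔ v y))

  _[_≔_] : Λ → 𝒱 → Λ → Λ
  M [ x ≔ N ] = M ● (ι , x ≔ N)

  data _∼α_ : Λ → Λ → Set (ℓv ⊔ ℓc) where
    α-c   : ∀ {k} → c k ∼α c k
    α-v   : ∀ {x} → v x ∼α v x
    α-app : ∀ {M M′ N N′} → M ∼α M′ → N ∼α N′ → (M · N) ∼α (M′ · N′)
    α-lam : ∀ {x x′ A A′ M M′} (y : 𝒱) → A ∼α A′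
          → ¬ (y ∈ (fv M - x)) → ¬ (y ∈ (fv M′ - x′))
          → M [ x ≔ v y ] ≡ M′ [ x′ ≔ v y ]
          → lam x A M ∼α lam x′ A′ M′
    α-pi  : ∀ {x x′ A A′ B B′} (y : 𝒱) → A ∼α A′
          → ¬ (y ∈ (fv B - x)) → ¬ (y ∈ (fv B′ - x′))
          → B [ x ≔ v y ] ≡ B′ [ x′ ≔ v y ]
          → pi x A B ∼α pi x′ A′ B′

  data Ctx {ℓ} (S : Λ → Λ → Set ℓ) : Λ → Λ → Set (ℓv ⊔ ℓc ⊔ ℓ) where
    base  : ∀ {M N} → S M N → Ctx S M N
    lam-b : ∀ {x A M M′} → Ctx S M M′ → Ctx S (lam x A M) (lam x A M′)
    lam-a : ∀ {x A A′ M} → Ctx S A A′ → Ctx S (lam x A M) (lam x A′ M)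
    pi-b  : ∀ {x A B B′} → Ctx S B B′ → Ctx S (pi x A B) (pi x A B′)
    pi-a  : ∀ {x A A′ B} → Ctx S A A′ → Ctx S (pi x A B) (pi x A′ B)
    app-l : ∀ {M M′ N} → Ctx S M M′ → Ctx S (M · N) (M′ · N)
    app-r : ∀ {M N N′} → Ctx S N N′ → Ctx S (M · N) (M · N′)

  data β-redex : Λ → Λ → Set (ℓv ⊔ ℓc) where
    β : ∀ {x A M N} → β-redex (lam x A M · N) (M [ x ≔ N ])

  _→β_ : Λ → Λ → Set (ℓv ⊔ ℓc)
  _→β_ = Ctx β-redex

  data _≃β_ : Λ → Λ → Set (ℓv ⊔ ℓc) where
    ≃-α     : ∀ {M N} → M ∼α N → M ≃β N
    ≃-β     : ∀ {M N} → M →β N → M ≃β N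
    ≃-refl  : ∀ {M} → M ≃β M
    ≃-sym   : ∀ {M N} → M ≃β N → N ≃β M
    ≃-trans : ∀ {M N P} → M ≃β N → N ≃β P → M ≃β P

  Context : Set (ℓv ⊔ ℓc)
  Context = List (𝒱 × Λ)

  _,,_∶_ : Context → 𝒱 → Λ → Context
  Γ ,, x ∶ A = (x , A) ∷ Γ

  dom : Context → List 𝒱
  dom = map (λ p → Data.Product.proj₁ p)

  data _ok : Context → Set (ℓv ⊔ ℓc ⊔ ℓa ⊔ ℓr)
  data _⊢_∶_ : Context → Λ → Λ → Set (ℓv ⊔ ℓc ⊔ ℓa ⊔ ℓr)

  data _ok where
    nil  : [] ok
    cons : ∀ {Γ x A s} → Γ ok → Γ ⊢ A ∶ c s → ¬ (x ∈ dom Γ) → (Γ ,, x ∶ A) ok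

  data _⊢_∶_ where
    sort : ∀ {Γ s₁ s₂} → Γ ok → 𝒜 s₁ s₂ → Γ ⊢ c s₁ ∶ c s₂
    prod : ∀ {Γ x A B s₁ s₂ s₃} → Γ ⊢ A ∶ c s₁
         → (∀ y → ¬ (y ∈ dom Γ) → (Γ ,, y ∶ A) ⊢ B [ x ≔ v y ] ∶ c s₂)
         → ℛ s₁ s₂ s₃ → Γ ⊢ pi x A B ∶ c s₃
    var  : ∀ {Γ x A} → Γ ok → (x , A) ∈ Γ → Γ ⊢ v x ∶ A
    abs  : ∀ {Γ x y A B M s₁ s₂ s₃} → Γ ⊢ A ∶ c s₁
         → (∀ z → ¬ (z ∈ dom Γ) → (Γ ,, z ∶ A) ⊢ B [ y ≔ v z ] ∶ c s₂)
         → (∀ z → ¬ (z ∈ dom Γ) → (Γ ,, z ∶ A) ⊢ M [ x ≔ v z ] ∶ B [ y ≔ v z ])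
         → ℛ s₁ s₂ s₃ → Γ ⊢ lam x A M ∶ pi y A B
    app  : ∀ {Γ M N x A B s} → Γ ⊢ M ∶ pi x A B → Γ ⊢ N ∶ A
         → Γ ⊢ B [ x ≔ N ] ∶ c s → Γ ⊢ M · N ∶ B [ x ≔ N ]
    conv : ∀ {Γ M A B s} → Γ ⊢ M ∶ A → A ≃β B → Γ ⊢ B ∶ c s → Γ ⊢ M ∶ B

-- Each typing rule other than var either concludes with a sort or carries a premise
-- typing its conclusion; for var, the type was checked by a sort when it
-- entered the context, and weakening transports that derivation to Γ.

module Submission where

open import Defs
open import Level using (Level)
open import Data.Nat using (ℕ)
open import Data.List using (List)
open import Data.List.Membership.Propositional using (_∈_)
open import Data.List.Relation.Binary.Subset.Propositional using (_⊆_)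
open import Data.List.Relation.Binary.Subset.Propositional.Properties
  using (map⁺; xs⊆x∷xs; ∷⁺ʳ)
open import Data.List.Relation.Unary.Any using (here; there)
open import Data.Product using (Σ; _,_; proj₁)
open import Data.Sum using (_⊎_; inj₁; inj₂)
open import Relation.Nullary using (¬_)
open import Relation.Binary.PropositionalEquality using (_≡_; refl)
open import Relation.Binary using (DecidableEquality)

module Correctness {ℓv ℓc ℓa ℓr : Level}
    (𝒱 : Set ℓv) (_≟_ : DecidableEquality 𝒱)
    (encode : 𝒱 → ℕ) (decode : ℕ → 𝒱)
    (encode-decode : ∀ n → encode (decode n) ≡ n)
    (𝒞 : Set ℓc)
    (χ′ : List ℕ → ℕ) (χ′-fresh : ∀ ns → ¬ (χ′ ns ∈ ns))
    (𝒜 : 𝒞 → 𝒞 → Set ℓa) (ℛ : 𝒞 → 𝒞 → 𝒞 → Set ℓr) where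
  open PTS 𝒱 _≟_ encode decode encode-decode 𝒞 χ′ χ′-fresh 𝒜 ℛ

  IsSortOrTyped : Context → Λ → Set _
  IsSortOrTyped Γ A = Σ 𝒞 λ s → (A ≡ c s) ⊎ (Γ ⊢ A ∶ c s)

  ∉-dom-⊆ : ∀ {Γ Δ y} → Γ ⊆ Δ → ¬ (y ∈ dom Δ) → ¬ (y ∈ dom Γ)
  ∉-dom-⊆ Γ⊆Δ y∉Δ y∈Γ = y∉Δ (map⁺ proj₁ Γ⊆Δ y∈Γ)

  ⊢-weaken : ∀ {Γ Δ M A} → Γ ⊆ Δ → Δ ok → Γ ⊢ M ∶ A → Δ ⊢ M ∶ A
  ⊢-weaken Γ⊆Δ Δ-ok (sort _ ax) = sort Δ-ok ax
  ⊢-weaken Γ⊆Δ Δ-ok (var _ x∈Γ) = var Δ-ok (Γ⊆Δ x∈Γ)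
  ⊢-weaken Γ⊆Δ Δ-ok (prod ⊢A ⊢B r) =
    prod ⊢A′ (λ y y∉Δ → ⊢-weaken (∷⁺ʳ _ Γ⊆Δ) (cons Δ-ok ⊢A′ y∉Δ) (⊢B y (∉-dom-⊆ Γ⊆Δ y∉Δ))) r
    where ⊢A′ = ⊢-weaken Γ⊆Δ Δ-ok ⊢A
  ⊢-weaken Γ⊆Δ Δ-ok (abs ⊢A ⊢B ⊢M r) =
    abs ⊢A′
      (λ z z∉Δ → ⊢-weaken (∷⁺ʳ _ Γ⊆Δ) (cons Δ-ok ⊢A′ z∉Δ) (⊢B z (∉-dom-⊆ Γ⊆Δ z∉Δ)))
      (λ z z∉Δ → ⊢-weaken (∷⁺ʳ _ Γ⊆Δ) (cons Δ-ok ⊢A′ z∉Δ) (⊢M z (∉-dom-⊆ Γ⊆Δ z∉Δ)))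
      r
    where ⊢A′ = ⊢-weaken Γ⊆Δ Δ-ok ⊢A
  ⊢-weaken Γ⊆Δ Δ-ok (app ⊢M ⊢N ⊢B) =
    app (⊢-weaken Γ⊆Δ Δ-ok ⊢M) (⊢-weaken Γ⊆Δ Δ-ok ⊢N) (⊢-weaken Γ⊆Δ Δ-ok ⊢B)
  ⊢-weaken Γ⊆Δ Δ-ok (conv ⊢M A≃B ⊢B) =
    conv (⊢-weaken Γ⊆Δ Δ-ok ⊢M) A≃B (⊢-weaken Γ⊆Δ Δ-ok ⊢B)

  ⊢-weaken-∷ : ∀ {Γ x A M B} → (Γ ,, x ∶ A) ok → Γ ⊢ M ∶ B → (Γ ,, x ∶ A) ⊢ M ∶ B
  ⊢-weaken-∷ = ⊢-weaken (xs⊆x∷xs _ _)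

  ok-∈⇒sortOrTyped : ∀ {Γ x A} → Γ ok → (x , A) ∈ Γ → IsSortOrTyped Γ A
  ok-∈⇒sortOrTyped Γ-ok@(cons {s = s} _ ⊢A _) (here refl) = s , inj₂ (⊢-weaken-∷ Γ-ok ⊢A)
  ok-∈⇒sortOrTyped Γ-ok@(cons Δ-ok _ _) (there x∈Δ) with ok-∈⇒sortOrTyped Δ-ok x∈Δ
  ... | s , inj₁ A≡s = s , inj₁ A≡s
  ... | s , inj₂ ⊢A  = s , inj₂ (⊢-weaken-∷ Γ-ok ⊢A)

  ⊢⇒type-sortOrTyped : ∀ Γ M A → Γ ⊢ M ∶ A → IsSortOrTyped Γ A
  ⊢⇒type-sortOrTyped Γ _ _ (sort {s₂ = s₂} _ _)         = s₂ , inj₁ refl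
  ⊢⇒type-sortOrTyped Γ _ _ (prod {s₃ = s₃} _ _ _)       = s₃ , inj₁ refl
  ⊢⇒type-sortOrTyped Γ _ _ (var Γ-ok x∈Γ)               = ok-∈⇒sortOrTyped Γ-ok x∈Γ
  ⊢⇒type-sortOrTyped Γ _ _ (abs {s₃ = s₃} ⊢A ⊢B _ r)   = s₃ , inj₂ (prod ⊢A ⊢B r)
  ⊢⇒type-sortOrTyped Γ _ _ (app {s = s} _ _ ⊢B[x≔N])   = s , inj₂ ⊢B[x≔N]
  ⊢⇒type-sortOrTyped Γ _ _ (conv {s = s} _ _ ⊢B)       = s , inj₂ ⊢B

lemma17 : {ℓv ℓc ℓa ℓr : Level}
    (𝒱 : Set ℓv) (_≟_ : DecidableEquality 𝒱)
    (encode : 𝒱 → ℕ) (decode : ℕ → 𝒱)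
    (encode-decode : ∀ n → encode (decode n) ≡ n)
    (𝒞 : Set ℓc)
    (χ′ : List ℕ → ℕ) (χ′-fresh : ∀ ns → ¬ (χ′ ns ∈ ns))
    (𝒜 : 𝒞 → 𝒞 → Set ℓa) (ℛ : 𝒞 → 𝒞 → 𝒞 → Set ℓr)
    → let open PTS 𝒱 _≟_ encode decode encode-decode 𝒞 χ′ χ′-fresh 𝒜 ℛ in
    ∀ (Γ : Context) (M A : Λ) → Γ ⊢ M ∶ A
    → Σ 𝒞 (λ s → (A ≡ c s) ⊎ (Γ ⊢ A ∶ c s))
lemma17 = Correctness.⊢⇒type-sortOrTyped
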